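{- Let $(X,d)$ and $(Y,e)$ be metric spaces, $E\subseteq X$, $f:E\to Y$, $K,L\subseteq\mathbb N$, $\alpha:K\to X$, $\beta:L\to Y$ with $\mathrm{rng}(\alpha)$ dense in $X$ and $\mathrm{rng}(\beta)$ dense in $Y$, and let $r_0,r_1,\ldots$ be a computable sequence of positive rationals having $0$ as an accumulation point. Let $S$ be a topological $(\alpha,\beta)$-approximation system for $f$, and let $$S'=\{(k',m',l,n)\in\mathbb N^4\mid k'\in K\ \&\ \exists k,m\,((k,m,l,n)\in S\ \&\ (\alpha(k'),m')<_d(\alpha(k),m))\}.$$ Then $S'$ is a metric $(\alpha,\beta)$-approximation system for $f$.
   Context: For $(x,m),(x',m')\in X\times\mathbb N$, $(x,m)<_d(x',m')$ means $d(x',x)<r_{m'}-r_m$. A topological $(\alpha,\beta)$-approximation system for $f$ is $S\subseteq K\times\mathbb N\times L\times\mathbb N$ such that for every $x\in E$ and $(l,n)\in L\times\mathbb N$: $e(\beta(l),f(x))<r_n$ iff there exist $k,m$ with $(k,m,l,n)\in S$ and $d(\alpha(k),x)<r_m$. A metric $(\alpha,\beta)$-approximation system for $f$ is $S\subseteq K\times\mathbb N\times L\times\mathbb N$ such that for every $x\in E$: (a) for all $(k,m,l,n)\in S$, $d(\alpha(k),x)<r_m$ implies $e(\beta(l),f(x))<r_n$; (b) for every $n$ there is $m$ such that for every $k\in K$ with $d(\alpha(k),x)<r_m$ there is $l$ with $(k,m,l,n)\in S$. -}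

module Defs where

open import Level using (Level; _⊔_; suc; 0ℓ)
open import Data.Nat using (ℕ)
open import Data.Rational using (ℚ; 0ℚ; _<_; _≤_; _+_; _-_)
open import Data.Product using (Σ; ∃; _×_; _,_; proj₁)
open import Relation.Binary.PropositionalEquality using (_≡_)

-- A metric space presented through its strict rational balls:
-- 'Ball x y q' means  d(x,y) < q.  The axioms below are exactly what
-- is needed for  d(x,y) := inf { q ∈ ℚ | Ball x y q }  to be a
-- (real-valued) metric with  d(x,y) < q  ⇔  Ball x y q, and conversely
-- every real metric yields such a ball relation.
record MetricSpace (a ℓ : Level) : Set (suc (a ⊔ ℓ)) where
  field
    Carrier   : Set a
    Ball      : Carrier → Carrier → ℚ → Set ℓ
    ball-pos  : ∀ {x y q} → Ball x y q → 0ℚ < q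
    ball-refl : ∀ x {q} → 0ℚ < q → Ball x x q
    ball-sym  : ∀ {x y q} → Ball x y q → Ball y x q
    ball-tri  : ∀ {x y z p q} → Ball x y p → Ball y z q → Ball x z (p + q)
    ball-mono : ∀ {x y p q} → Ball x y p → p ≤ q → Ball x y q
    ball-open : ∀ {x y q} → Ball x y q → Σ ℚ λ p → p < q × Ball x y p
    ball-fin  : ∀ x y → Σ ℚ λ q → Ball x y q
    ball-sep  : ∀ {x y} → (∀ q → 0ℚ < q → Ball x y q) → x ≡ y

open MetricSpace public

module _ {a ℓ : Level} (M : MetricSpace a ℓ) where
  _d<_ : Carrier M × Carrier M → ℚ → Set ℓ
  (x , y) d< q = Ball M x y q

  Dense : {K : ℕ → Set} → (Σ ℕ K → Carrier M) → Set (a ⊔ ℓ)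
  Dense α = ∀ x q → 0ℚ < q → Σ _ λ k → Ball M (α k) x q

  -- (x,m) <_d (x',m')  iff  d(x',x) < r_{m'} - r_m
  Below : (ℕ → ℚ) → Carrier M → ℕ → Carrier M → ℕ → Set ℓ
  Below r x m x′ m′ = Ball M x′ x (r m′ - r m)

-- r is a sequence of positive rationals with 0 as an accumulation point
-- (every Agda function ℕ → ℚ is computable).
PositiveSeq : (ℕ → ℚ) → Set
PositiveSeq r = ∀ n → 0ℚ < r n

ZeroAccumulates : (ℕ → ℚ) → Set
ZeroAccumulates r = ∀ ε → 0ℚ < ε → Σ ℕ λ n → r n < ε

module _ {a b ℓ₁ ℓ₂ : Level} (X : MetricSpace a ℓ₁) (Y : MetricSpace b ℓ₂)
         (r : ℕ → ℚ) (E : Carrier X → Set) (f : Σ (Carrier X) E → Carrier Y)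
         {K L : ℕ → Set} (α : Σ ℕ K → Carrier X) (β : Σ ℕ L → Carrier Y) where

  ApproxRel : (s : Level) → Set (suc s)
  ApproxRel s = Σ ℕ K → ℕ → Σ ℕ L → ℕ → Set s

  TopologicalApprox : ∀ {s} → ApproxRel s → Set (a ⊔ ℓ₁ ⊔ ℓ₂ ⊔ s)
  TopologicalApprox S = ∀ (x : Carrier X) (ex : E x) (l : Σ ℕ L) (n : ℕ) →
    (Ball Y (β l) (f (x , ex)) (r n) →
       Σ (Σ ℕ K) λ k → Σ ℕ λ m → S k m l n × Ball X (α k) x (r m))
    × ((Σ (Σ ℕ K) λ k → Σ ℕ λ m → S k m l n × Ball X (α k) x (r m)) →
       Ball Y (β l) (f (x , ex)) (r n))

  MetricApprox : ∀ {s} → ApproxRel s → Set (a ⊔ ℓ₁ ⊔ ℓ₂ ⊔ s)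
  MetricApprox S = ∀ (x : Carrier X) (ex : E x) →
    (∀ k m l n → S k m l n → Ball X (α k) x (r m) → Ball Y (β l) (f (x , ex)) (r n))
    × (∀ n → Σ ℕ λ m → ∀ k → Ball X (α k) x (r m) → Σ (Σ ℕ L) λ l → S k m l n)

  Derived : ApproxRel 0ℓ → ApproxRel ℓ₁
  Derived S k′ m′ l n = Σ (Σ ℕ K) λ k → Σ ℕ λ m → S k m l n × Below X r (α k′) m′ (α k) m

module Submission where

open import Defs
open import Level using (Level)
open import Data.Nat using (ℕ)
open import Data.Rational using (ℚ; 0ℚ; ½; _+_; _-_; _*_; -_; _<_; _≤_)
open import Data.Rational.Properties
  using (+-inverseʳ; +-monoˡ-<; +-monoˡ-≤; +-mono-<; *-zeroʳ; *-monoʳ-<-pos; <⇒≤; ≤-reflexive)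
open import Data.Rational.Solver using (module +-*-Solver)
open import Data.Product using (Σ; _,_; proj₁; proj₂)
open import Relation.Binary.PropositionalEquality using (_≡_; refl; subst; subst₂)

-- The inclusion part of S' is the triangle inequality: (α k′, m′) <_d (α k, m) turns
-- the ball B(α k′, r m′) into a subset of B(α k, r m).  For the uniformity part, the
-- topological system gives a ball B(α k, r m₀) containing x and approximating f x to
-- within r n; as balls are open, x lies in a smaller ball B(α k, p), and any m with
-- 2 r m < r m₀ − p makes every (α k′, m) with d(α k′, x) < r m lie below (α k, m₀).

open +-*-Solver

p-q+q≡p : ∀ p q → (p - q) + q ≡ p
p-q+q≡p = solve 2 (λ p q → (p :- q) :+ q := p) refl

p<q⇒0<q-p : ∀ {p q} → p < q → 0ℚ < q - p
p<q⇒0<q-p {p} {q} p<q = subst (_< q - p) (+-inverseʳ p) (+-monoˡ-< (- p) p<q)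

0<½*p : ∀ {p} → 0ℚ < p → 0ℚ < ½ * p
0<½*p {p} 0<p = subst (_< ½ * p) (*-zeroʳ ½) (*-monoʳ-<-pos ½ 0<p)

ε<½*[q-p]⇒p+ε≤q-ε : ∀ p q {ε} → ε < ½ * (q - p) → p + ε ≤ q - ε
ε<½*[q-p]⇒p+ε≤q-ε p q {ε} ε<½d =
  subst₂ _≤_ (rearrangeˡ ε p) (rearrangeʳ ε p q) (+-monoˡ-≤ (p - ε) (<⇒≤ ε+ε<q-p))
  where
  halves : ∀ d → ½ * d + ½ * d ≡ d
  halves = solve 1 (λ d → con ½ :* d :+ con ½ :* d := d) refl

  rearrangeˡ : ∀ ε p → (ε + ε) + (p - ε) ≡ p + ε
  rearrangeˡ = solve 2 (λ ε p → (ε :+ ε) :+ (p :- ε) := p :+ ε) refl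

  rearrangeʳ : ∀ ε p q → (q - p) + (p - ε) ≡ q - ε
  rearrangeʳ = solve 3 (λ ε p q → (q :- p) :+ (p :- ε) := q :- ε) refl

  ε+ε<q-p : ε + ε < q - p
  ε+ε<q-p = subst (ε + ε <_) (halves (q - p)) (+-mono-< ε<½d ε<½d)

module _ {a ℓ : Level} (M : MetricSpace a ℓ) (r : ℕ → ℚ) where

  ball-below : ∀ {x x′ y m m′} → Below M r x m x′ m′ → Ball M x y (r m) → Ball M x′ y (r m′)
  ball-below {m = m} {m′} x′x<gap xy<rm =
    ball-mono M (ball-tri M x′x<gap xy<rm) (≤-reflexive (p-q+q≡p (r m′) (r m)))

  below-of-ball : ZeroAccumulates r → ∀ {c x m₀} → Ball M c x (r m₀) →
                  Σ ℕ λ m → ∀ {y} → Ball M y x (r m) → Below M r y m c m₀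
  below-of-ball r→0 {m₀ = m₀} cx<rm₀ with ball-open M cx<rm₀
  ... | p , p<rm₀ , cx<p with r→0 (½ * (r m₀ - p)) (0<½*p (p<q⇒0<q-p p<rm₀))
  ... | m , rm<½gap = m , λ yx<rm →
        ball-mono M (ball-tri M cx<p (ball-sym M yx<rm)) (ε<½*[q-p]⇒p+ε≤q-ε p (r m₀) rm<½gap)

theorem3p38 : ∀ {a b ℓ₁ ℓ₂ : Level} (X : MetricSpace a ℓ₁) (Y : MetricSpace b ℓ₂)
    (E : Carrier X → Set) (f : Σ (Carrier X) E → Carrier Y)
    {K L : ℕ → Set} (α : Σ ℕ K → Carrier X) (β : Σ ℕ L → Carrier Y)
    → Dense X α → Dense Y β
    → (r : ℕ → ℚ) → PositiveSeq r → ZeroAccumulates r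
    → (S : ApproxRel X Y r E f α β Level.zero) → TopologicalApprox X Y r E f α β S
    → MetricApprox X Y r E f α β (Derived X Y r E f α β S)
theorem3p38 X Y E f α β _ β-dense r r-pos r→0 S S-top x ex = sound , uniform
  where
  sound : ∀ k′ m′ l n → Derived X Y r E f α β S k′ m′ l n →
          Ball X (α k′) x (r m′) → Ball Y (β l) (f (x , ex)) (r n)
  sound k′ m′ l n (k , m , s , below) k′x<rm′ =
    proj₂ (S-top x ex l n) (k , m , s , ball-below X r below k′x<rm′)

  uniform : ∀ n → Σ ℕ λ m → ∀ k′ → Ball X (α k′) x (r m) →
            Σ _ λ l → Derived X Y r E f α β S k′ m l n
  uniform n =
    let l , lfx<rn          = β-dense (f (x , ex)) (r n) (r-pos n)
        k , m₀ , s , kx<rm₀ = proj₁ (S-top x ex l n) lfx<rn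
        m , below           = below-of-ball X r r→0 kx<rm₀
    in  m , λ k′ k′x<rm → l , k , m₀ , s , below k′x<rm
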